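{- Let $\vec G$ be a wfgv such that $Y\vec G=Y$ for every fpc $Y$. Then $\vec G$ is the empty sequence $()$.
   Context: Untyped $\lambda$-calculus; $=$ denotes $\beta$-conversion. For a finite sequence $\vec G=(G_0,\dots,G_n)$ of terms, $M\vec G=MG_0\cdots G_n$, and $M()=M$. $M=^\infty N$ means $M$ and $N$ have the same Böhm tree. A term $Y$ is a fixed point combinator (fpc) if $Yx=x(Yx)$ for a variable $x$ not free in $Y$; it is a weak fpc (wfpc) if $Yx=^\infty x(Yx)$ for such $x$. A finite sequence $\vec G$ is a weak fpc generating vector (wfgv) if $Y$ wfpc implies $Y\vec G$ wfpc. -}

module Defs where

open import Data.Nat using (ℕ; zero; suc)
open import Data.List using (List; []; _∷_)
open import Data.List.Relation.Binary.Pointwise using (Pointwise)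
open import Data.Product using (Σ; ∃; _×_; _,_)
open import Data.Sum using (_⊎_)
open import Data.Unit using (⊤)
open import Relation.Nullary using (¬_)
open import Relation.Binary.PropositionalEquality using (_≡_)

-- Untyped λ-terms, de Bruijn indices (free variables = indices escaping all binders)
data Term : Set where
  var : ℕ → Term
  app : Term → Term → Term
  lam : Term → Term

ext : (ℕ → ℕ) → ℕ → ℕ
ext ρ zero    = zero
ext ρ (suc i) = suc (ρ i)

rename : (ℕ → ℕ) → Term → Term
rename ρ (var i)   = var (ρ i)
rename ρ (app M N) = app (rename ρ M) (rename ρ N)
rename ρ (lam M)   = lam (rename (ext ρ) M)

exts : (ℕ → Term) → ℕ → Term
exts σ zero    = var zero
exts σ (suc i) = rename suc (σ i)

subst : (ℕ → Term) → Term → Term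
subst σ (var i)   = σ i
subst σ (app M N) = app (subst σ M) (subst σ N)
subst σ (lam M)   = lam (subst (exts σ) M)

sub0 : Term → ℕ → Term
sub0 N zero    = N
sub0 N (suc i) = var i

_[_] : Term → Term → Term
M [ N ] = subst (sub0 N) M

data _⟶β_ : Term → Term → Set where
  β    : ∀ {M N} → app (lam M) N ⟶β (M [ N ])
  appL : ∀ {M M' N} → M ⟶β M' → app M N ⟶β app M' N
  appR : ∀ {M N N'} → N ⟶β N' → app M N ⟶β app M N'
  ξ    : ∀ {M M'} → M ⟶β M' → lam M ⟶β lam M'

infix 4 _=β_
data _=β_ : Term → Term → Set where
  step  : ∀ {M N} → M ⟶β N → M =β N
  refl  : ∀ {M} → M =β M
  sym   : ∀ {M N} → M =β N → N =β M
  trans : ∀ {M N P} → M =β N → N =β P → M =β P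

apps : Term → List Term → Term
apps M []       = M
apps M (G ∷ Gs) = apps (app M G) Gs

lams : ℕ → Term → Term
lams zero    M = M
lams (suc k) M = lam (lams k M)

HasHNF : Term → Set
HasHNF M = Σ ℕ λ k → Σ ℕ λ y → Σ (List Term) λ Ps → M =β lams k (apps (var y) Ps)

-- Böhm trees agree up to depth n
BTEq : ℕ → Term → Term → Set
BTEq zero    M N = ⊤
BTEq (suc n) M N =
  (¬ HasHNF M × ¬ HasHNF N) ⊎
  (Σ ℕ λ k → Σ ℕ λ y → Σ (List Term) λ Ps → Σ (List Term) λ Qs →
     (M =β lams k (apps (var y) Ps)) × (N =β lams k (apps (var y) Qs)) ×
     Pointwise (BTEq n) Ps Qs)

infix 4 _=∞_
_=∞_ : Term → Term → Set
M =∞ N = ∀ n → BTEq n M N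

Free : ℕ → Term → Set
Free x (var y)   = x ≡ y
Free x (app M N) = Free x M ⊎ Free x N
Free x (lam M)   = Free (suc x) M

IsFPC : Term → Set
IsFPC Y = ∀ x → ¬ Free x Y → app Y (var x) =β app (var x) (app Y (var x))

IsWFPC : Term → Set
IsWFPC Y = ∀ x → ¬ Free x Y → app Y (var x) =∞ app (var x) (app Y (var x))

IsWFGV : List Term → Set
IsWFGV Gs = ∀ Y → IsWFPC Y → IsWFPC (apps Y Gs)

module Submission where

-- Take z fresh for G⃗ and the fpc Θ z = W W z, Turing's combinator threading an inert
-- parameter z.  Θ z reduces to λf. f (Θ z f), and in every reduct of this abstraction a
-- reduct of Θ z stays applied to the bound variable f.  In every reduct of Θ z G⃗, on
-- the contrary, each occurrence of z heads a reduct of Θ z applied to an argument that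
-- mentions no locally bound variable.  Both invariants are preserved by β-reduction and
-- exclude each other, so by Church–Rosser Θ z G⃗ ≠β Θ z for non-empty G⃗.

open import Defs
open import Data.Empty using (⊥-elim)
open import Data.List using (List; []; _∷_; map)
open import Data.List.Extrema.Nat using (max; xs≤max)
open import Data.List.Relation.Unary.All as All using (All; []; _∷_)
open import Data.List.Relation.Unary.All.Properties using (map⁻)
open import Data.Nat using (ℕ; zero; suc; _+_; _≤_; _<_; _<?_; _⊔_; pred; z≤n; s≤s)
open import Data.Nat.Properties
  using (+-cancelˡ-≡; <⇒≢; <⇒≱; ≮⇒≥; <-≤-trans; ≤-refl; m≤m+n; m≤m⊔n; m≤n⊔m; m≤n⇒∃[o]m+o≡n)
open import Data.Product using (∃; _×_; _,_; map₁; map₂)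
open import Data.Sum using (_⊎_; inj₁; inj₂)
open import Function using (_∘_; id)
open import Relation.Binary.Construct.Closure.ReflexiveTransitive
  using (Star; ε; _◅_; _◅◅_; gmap; _⋆)
import Relation.Binary.PropositionalEquality as ≡
open ≡ using (_≡_; _≢_; _≗_; cong; cong₂)
open ≡.≡-Reasoning
open import Relation.Nullary using (¬_; yes; no)

ext-cong : ∀ {ρ ρ′} → ρ ≗ ρ′ → ext ρ ≗ ext ρ′
ext-cong h zero    = ≡.refl
ext-cong h (suc i) = cong suc (h i)

rename-cong : ∀ {ρ ρ′} → ρ ≗ ρ′ → rename ρ ≗ rename ρ′
rename-cong h (var i)   = cong var (h i)
rename-cong h (app M N) = cong₂ app (rename-cong h M) (rename-cong h N)
rename-cong h (lam M)   = cong lam (rename-cong (ext-cong h) M)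

exts-cong : ∀ {σ σ′} → σ ≗ σ′ → exts σ ≗ exts σ′
exts-cong h zero    = ≡.refl
exts-cong h (suc i) = cong (rename suc) (h i)

subst-cong : ∀ {σ σ′} → σ ≗ σ′ → subst σ ≗ subst σ′
subst-cong h (var i)   = h i
subst-cong h (app M N) = cong₂ app (subst-cong h M) (subst-cong h N)
subst-cong h (lam M)   = cong lam (subst-cong (exts-cong h) M)

rename-rename : ∀ ρ ρ′ → rename ρ ∘ rename ρ′ ≗ rename (ρ ∘ ρ′)
rename-rename ρ ρ′ (var i)   = ≡.refl
rename-rename ρ ρ′ (app M N) = cong₂ app (rename-rename ρ ρ′ M) (rename-rename ρ ρ′ N)
rename-rename ρ ρ′ (lam M)   = cong lam (≡.trans (rename-rename (ext ρ) (ext ρ′) M)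
  (rename-cong (λ { zero → ≡.refl ; (suc i) → ≡.refl }) M))

subst-rename : ∀ σ ρ → subst σ ∘ rename ρ ≗ subst (σ ∘ ρ)
subst-rename σ ρ (var i)   = ≡.refl
subst-rename σ ρ (app M N) = cong₂ app (subst-rename σ ρ M) (subst-rename σ ρ N)
subst-rename σ ρ (lam M)   = cong lam (≡.trans (subst-rename (exts σ) (ext ρ) M)
  (subst-cong (λ { zero → ≡.refl ; (suc i) → ≡.refl }) M))

rename-subst : ∀ ρ σ → rename ρ ∘ subst σ ≗ subst (rename ρ ∘ σ)
rename-subst ρ σ (var i)   = ≡.refl
rename-subst ρ σ (app M N) = cong₂ app (rename-subst ρ σ M) (rename-subst ρ σ N)
rename-subst ρ σ (lam M)   = cong lam (≡.trans (rename-subst (ext ρ) (exts σ) M)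
  (subst-cong (λ { zero → ≡.refl
                 ; (suc i) → ≡.trans (rename-rename (ext ρ) suc (σ i))
                                     (≡.sym (rename-rename suc ρ (σ i))) }) M))

subst-subst : ∀ τ σ → subst τ ∘ subst σ ≗ subst (subst τ ∘ σ)
subst-subst τ σ (var i)   = ≡.refl
subst-subst τ σ (app M N) = cong₂ app (subst-subst τ σ M) (subst-subst τ σ N)
subst-subst τ σ (lam M)   = cong lam (≡.trans (subst-subst (exts τ) (exts σ) M)
  (subst-cong (λ { zero → ≡.refl
                 ; (suc i) → ≡.trans (subst-rename (exts τ) suc (σ i))
                                     (≡.sym (rename-subst suc τ (σ i))) }) M))

subst-var : subst var ≗ id
subst-var (var i)   = ≡.refl
subst-var (app M N) = cong₂ app (subst-var M) (subst-var N)
subst-var (lam M)   =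
  cong lam (≡.trans (subst-cong (λ { zero → ≡.refl ; (suc i) → ≡.refl }) M) (subst-var M))

rename-is-subst : ∀ ρ → rename ρ ≗ subst (var ∘ ρ)
rename-is-subst ρ (var i)   = ≡.refl
rename-is-subst ρ (app M N) = cong₂ app (rename-is-subst ρ M) (rename-is-subst ρ N)
rename-is-subst ρ (lam M)   = cong lam (≡.trans (rename-is-subst (ext ρ) M)
  (subst-cong (λ { zero → ≡.refl ; (suc i) → ≡.refl }) M))

subst-[] : ∀ σ M N → subst σ (M [ N ]) ≡ subst (exts σ) M [ subst σ N ]
subst-[] σ M N = begin
  subst σ (M [ N ])                             ≡⟨ subst-subst σ (sub0 N) M ⟩
  subst (subst σ ∘ sub0 N) M                    ≡⟨ subst-cong commute M ⟩
  subst (subst (sub0 (subst σ N)) ∘ exts σ) M   ≡⟨ subst-subst (sub0 (subst σ N)) (exts σ) M ⟨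
  subst (exts σ) M [ subst σ N ]                ∎
  where
  commute : subst σ ∘ sub0 N ≗ subst (sub0 (subst σ N)) ∘ exts σ
  commute zero    = ≡.refl
  commute (suc i) = ≡.sym (≡.trans (subst-rename (sub0 (subst σ N)) suc (σ i)) (subst-var (σ i)))

rename-[] : ∀ ρ M N → rename ρ (M [ N ]) ≡ rename (ext ρ) M [ rename ρ N ]
rename-[] ρ M N = begin
  rename ρ (M [ N ])                            ≡⟨ rename-subst ρ (sub0 N) M ⟩
  subst (rename ρ ∘ sub0 N) M                   ≡⟨ subst-cong (λ { zero → ≡.refl ; (suc i) → ≡.refl }) M ⟩
  subst (sub0 (rename ρ N) ∘ ext ρ) M           ≡⟨ subst-rename (sub0 (rename ρ N)) (ext ρ) M ⟨
  rename (ext ρ) M [ rename ρ N ]               ∎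

infix 4 _⇛_ _⇛*_ _↠_

data _⇛_ : Term → Term → Set where
  pvar : ∀ {i} → var i ⇛ var i
  papp : ∀ {M M′ N N′} → M ⇛ M′ → N ⇛ N′ → app M N ⇛ app M′ N′
  plam : ∀ {M M′} → M ⇛ M′ → lam M ⇛ lam M′
  pβ   : ∀ {M M′ N N′} → M ⇛ M′ → N ⇛ N′ → app (lam M) N ⇛ M′ [ N′ ]

_⇛*_ : Term → Term → Set
_⇛*_ = Star _⇛_

_↠_ : Term → Term → Set
_↠_ = Star _⟶β_

⇛-refl : ∀ M → M ⇛ M
⇛-refl (var i)   = pvar
⇛-refl (app M N) = papp (⇛-refl M) (⇛-refl N)
⇛-refl (lam M)   = plam (⇛-refl M)

⇛-rename : ∀ ρ {M M′} → M ⇛ M′ → rename ρ M ⇛ rename ρ M′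
⇛-rename ρ pvar       = pvar
⇛-rename ρ (papp p q) = papp (⇛-rename ρ p) (⇛-rename ρ q)
⇛-rename ρ (plam p)   = plam (⇛-rename (ext ρ) p)
⇛-rename ρ (pβ {M′ = M′} {N′ = N′} p q) =
  ≡.subst (λ T → _ ⇛ T) (≡.sym (rename-[] ρ M′ N′))
          (pβ (⇛-rename (ext ρ) p) (⇛-rename ρ q))

⇛-exts : ∀ {σ σ′} → (∀ i → σ i ⇛ σ′ i) → ∀ i → exts σ i ⇛ exts σ′ i
⇛-exts h zero    = pvar
⇛-exts h (suc i) = ⇛-rename suc (h i)

⇛-subst : ∀ {σ σ′} → (∀ i → σ i ⇛ σ′ i) → ∀ {M M′} → M ⇛ M′ → subst σ M ⇛ subst σ′ M′
⇛-subst h (pvar {i}) = h i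
⇛-subst h (papp p q) = papp (⇛-subst h p) (⇛-subst h q)
⇛-subst h (plam p)   = plam (⇛-subst (⇛-exts h) p)
⇛-subst {σ′ = σ′} h (pβ {M′ = M′} {N′ = N′} p q) =
  ≡.subst (λ T → _ ⇛ T) (≡.sym (subst-[] σ′ M′ N′))
          (pβ (⇛-subst (⇛-exts h) p) (⇛-subst h q))

⇛-[] : ∀ {M M′ N N′} → M ⇛ M′ → N ⇛ N′ → M [ N ] ⇛ M′ [ N′ ]
⇛-[] p q = ⇛-subst (λ { zero → q ; (suc i) → pvar }) p

develop : Term → Term
develop (var i)            = var i
develop (lam M)            = lam (develop M)
develop (app (lam M) N)    = develop M [ develop N ]
develop (app (var i) N)    = app (var i) (develop N)
develop (app (app M M′) N) = app (develop (app M M′)) (develop N)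

⇛-develop : ∀ {M N} → M ⇛ N → N ⇛ develop M
⇛-develop pvar                          = pvar
⇛-develop (plam p)                      = plam (⇛-develop p)
⇛-develop (pβ p q)                      = ⇛-[] (⇛-develop p) (⇛-develop q)
⇛-develop (papp {M = var _} pvar q)     = papp pvar (⇛-develop q)
⇛-develop (papp {M = app _ _} p q)      = papp (⇛-develop p) (⇛-develop q)
⇛-develop (papp {M = lam _} (plam p) q) = pβ (⇛-develop p) (⇛-develop q)

strip : ∀ {M N P} → M ⇛ N → M ⇛* P → ∃ λ R → N ⇛* R × P ⇛ R
strip M⇛N ε = _ , ε , M⇛N
strip M⇛N (M⇛Q ◅ Q⇛*P) with strip (⇛-develop M⇛Q) Q⇛*P
... | R , dev⇛*R , P⇛R = R , ⇛-develop M⇛N ◅ dev⇛*R , P⇛R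

⇛*-confluent : ∀ {M N P} → M ⇛* N → M ⇛* P → ∃ λ R → N ⇛* R × P ⇛* R
⇛*-confluent ε M⇛*P = _ , M⇛*P , ε
⇛*-confluent (M⇛Q ◅ Q⇛*N) M⇛*P with strip M⇛Q M⇛*P
... | S , Q⇛*S , P⇛S with ⇛*-confluent Q⇛*N Q⇛*S
... | R , N⇛*R , S⇛*R = R , N⇛*R , P⇛S ◅ S⇛*R

⟶β⇒⇛ : ∀ {M N} → M ⟶β N → M ⇛ N
⟶β⇒⇛ (β {M} {N})       = pβ (⇛-refl M) (⇛-refl N)
⟶β⇒⇛ (appL {N = N} s)  = papp (⟶β⇒⇛ s) (⇛-refl N)
⟶β⇒⇛ (appR {M = M} s)  = papp (⇛-refl M) (⟶β⇒⇛ s)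
⟶β⇒⇛ (ξ s)             = plam (⟶β⇒⇛ s)

=β⇒⇛*-joinable : ∀ {M N} → M =β N → ∃ λ R → M ⇛* R × N ⇛* R
=β⇒⇛*-joinable (step s) = _ , ⟶β⇒⇛ s ◅ ε , ε
=β⇒⇛*-joinable refl     = _ , ε , ε
=β⇒⇛*-joinable (sym M=N) with =β⇒⇛*-joinable M=N
... | R , M⇛*R , N⇛*R = R , N⇛*R , M⇛*R
=β⇒⇛*-joinable (trans M=N N=P) with =β⇒⇛*-joinable M=N | =β⇒⇛*-joinable N=P
... | R , M⇛*R , N⇛*R | S , N⇛*S , P⇛*S with ⇛*-confluent N⇛*R N⇛*S
... | T , R⇛*T , S⇛*T = T , M⇛*R ◅◅ R⇛*T , P⇛*S ◅◅ S⇛*T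

↠-appˡ : ∀ {M M′ N} → M ↠ M′ → app M N ↠ app M′ N
↠-appˡ = gmap _ appL

↠-appʳ : ∀ {M N N′} → N ↠ N′ → app M N ↠ app M N′
↠-appʳ = gmap _ appR

↠-lam : ∀ {M M′} → M ↠ M′ → lam M ↠ lam M′
↠-lam = gmap _ ξ

⇛⇒↠ : ∀ {M N} → M ⇛ N → M ↠ N
⇛⇒↠ pvar       = ε
⇛⇒↠ (papp p q) = ↠-appˡ (⇛⇒↠ p) ◅◅ ↠-appʳ (⇛⇒↠ q)
⇛⇒↠ (plam p)   = ↠-lam (⇛⇒↠ p)
⇛⇒↠ (pβ p q)   = ↠-appˡ (↠-lam (⇛⇒↠ p)) ◅◅ ↠-appʳ (⇛⇒↠ q) ◅◅ β ◅ ε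

church-rosser : ∀ {M N} → M =β N → ∃ λ R → M ↠ R × N ↠ R
church-rosser M=N with =β⇒⇛*-joinable M=N
... | R , M⇛*R , N⇛*R = R , (⇛⇒↠ ⋆) M⇛*R , (⇛⇒↠ ⋆) N⇛*R

↠-preserves : ∀ {P : Term → Set} → (∀ {M N} → P M → M ⟶β N → P N) →
              ∀ {M N} → P M → M ↠ N → P N
↠-preserves pres p ε        = p
↠-preserves pres p (s ◅ ss) = ↠-preserves pres (pres p s) ss

free-rename : ∀ ρ M {x} → Free x (rename ρ M) → ∃ λ y → x ≡ ρ y × Free y M
free-rename ρ (var i)   x≡ρi      = i , x≡ρi , ≡.refl
free-rename ρ (app M N) (inj₁ fx) = map₂ (map₂ inj₁) (free-rename ρ M fx)
free-rename ρ (app M N) (inj₂ fx) = map₂ (map₂ inj₂) (free-rename ρ N fx)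
free-rename ρ (lam M)   fx with free-rename (ext ρ) M fx
... | suc y , x≡ρy , fy = y , cong pred x≡ρy , fy

free-subst : ∀ σ M {x} → Free x (subst σ M) → ∃ λ y → Free y M × Free x (σ y)
free-subst σ (var i)   fx        = i , ≡.refl , fx
free-subst σ (app M N) (inj₁ fx) = map₂ (map₁ inj₁) (free-subst σ M fx)
free-subst σ (app M N) (inj₂ fx) = map₂ (map₁ inj₂) (free-subst σ N fx)
free-subst σ (lam M)   fx with free-subst (exts σ) M fx
... | suc y , fy , fx′ with free-rename suc (σ y) fx′
...   | _ , ≡.refl , fx″ = y , fy , fx″

free-⟶β : ∀ {M N x} → M ⟶β N → Free x N → Free x M
free-⟶β (β {M} {N}) fx with free-subst (sub0 N) M fx
... | zero  , _  , fx′    = inj₂ fx′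
... | suc y , fy , ≡.refl = inj₁ fy
free-⟶β (appL s) (inj₁ fx) = inj₁ (free-⟶β s fx)
free-⟶β (appL s) (inj₂ fx) = inj₂ fx
free-⟶β (appR s) (inj₁ fx) = inj₁ fx
free-⟶β (appR s) (inj₂ fx) = inj₂ (free-⟶β s fx)
free-⟶β (ξ s)    fx        = free-⟶β s fx

freeBound : Term → ℕ
freeBound (var i)   = suc i
freeBound (app M N) = freeBound M ⊔ freeBound N
freeBound (lam M)   = pred (freeBound M)

free⇒<freeBound : ∀ {x} M → Free x M → x < freeBound M
free⇒<freeBound (var i)   ≡.refl    = ≤-refl
free⇒<freeBound (app M N) (inj₁ fx) =
  <-≤-trans (free⇒<freeBound M fx) (m≤m⊔n (freeBound M) (freeBound N))
free⇒<freeBound (app M N) (inj₂ fx) =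
  <-≤-trans (free⇒<freeBound N fx) (m≤n⊔m (freeBound M) (freeBound N))
free⇒<freeBound (lam M)   fx with freeBound M | free⇒<freeBound M fx
... | suc _ | s≤s x<b = x<b

fresh-for : (Gs : List Term) → ∃ λ z → All (λ G → ¬ Free z G) Gs
fresh-for Gs = max 0 (map freeBound Gs) ,
  All.map (λ {G} bound≤z fz → <⇒≱ (free⇒<freeBound G fz) bound≤z)
          (map⁻ (xs≤max 0 (map freeBound Gs)))

NoLocal : ℕ → Term → Set
NoLocal d N = ∀ {x} → Free x N → d ≤ x

NoLocal-⟶β : ∀ {d N N′} → N ⟶β N′ → NoLocal d N → NoLocal d N′
NoLocal-⟶β s noLocal = noLocal ∘ free-⟶β s

NoLocal-rename : ∀ {d d′} ρ → (∀ j → ρ (d + j) ≡ d′ + j) →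
                 ∀ N → NoLocal d N → NoLocal d′ (rename ρ N)
NoLocal-rename {d} {d′} ρ shift N noLocal fx with free-rename ρ N fx
... | y , ≡.refl , fy with m≤n⇒∃[o]m+o≡n (noLocal fy)
... | j , ≡.refl = ≡.subst (d′ ≤_) (≡.sym (shift j)) (m≤m+n d′ j)

NoLocal-subst : ∀ {d d′} σ → (∀ j → σ (d + j) ≡ var (d′ + j)) →
                ∀ N → NoLocal d N → NoLocal d′ (subst σ N)
NoLocal-subst {d} {d′} σ shift N noLocal {x} fx with free-subst σ N fx
... | y , fy , fx′ with m≤n⇒∃[o]m+o≡n (noLocal fy)
... | j , ≡.refl = ≡.subst (d′ ≤_) (≡.sym (≡.subst (Free x) (shift j) fx′)) (m≤m+n d′ j)

local-or-global : ∀ d i → i < d ⊎ ∃ λ j → d + j ≡ i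
local-or-global d i with i <? d
... | yes i<d = inj₁ i<d
... | no  i≮d = inj₂ (m≤n⇒∃[o]m+o≡n (≮⇒≥ i≮d))

W : Term
W = lam (lam (lam (app (var 0) (app (app (app (var 2) (var 2)) (var 1)) (var 0)))))

Θ : ℕ → Term
Θ k = app (app W W) (var k)

Θ-fpc : ∀ k → IsFPC (Θ k)
Θ-fpc k x _ = trans (step (appL (appL β))) (trans (step (appL β)) (step β))

W-normal : ∀ {M} → ¬ (W ⟶β M)
W-normal (ξ (ξ (ξ (appL ()))))
W-normal (ξ (ξ (ξ (appR (appL (appL (appL ())))))))
W-normal (ξ (ξ (ξ (appR (appL (appL (appR ())))))))
W-normal (ξ (ξ (ξ (appR (appL (appR ()))))))
W-normal (ξ (ξ (ξ (appR (appR ())))))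

-- The reducts of Θ k are W W (var k), (λ y f. B) (var k) and λ f. B′, where B, B′ have
-- the shape f (f (⋯ (T f))) with T again a reduct of Θ k.  In ΘBody k B the variable f
-- is var 0 and the parameter of Θ is var k.
data ΘBody : ℕ → Term → Set

data ΘReduct : ℕ → Term → Set where
  start    : ∀ {k} → ΘReduct k (Θ k)
  unfolded : ∀ {k B} → ΘBody 1 B → ΘReduct k (app (lam (lam B)) (var k))
  opened   : ∀ {k B} → ΘBody (suc k) B → ΘReduct k (lam B)

data ΘBody where
  f∙_ : ∀ {k B} → ΘBody k B → ΘBody k (app (var 0) B)
  _∙f : ∀ {k T} → ΘReduct k T → ΘBody k (app T (var 0))

ΘBody-subst : ∀ {k k′ B} τ → τ 0 ≡ var 0 → τ k ≡ var k′ → ΘBody k B → ΘBody k′ (subst τ B)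
ΘReduct-subst : ∀ {k k′ T} τ → τ k ≡ var k′ → ΘReduct k T → ΘReduct k′ (subst τ T)

ΘBody-subst τ τ0 τk (f∙ b) rewrite τ0 = f∙ ΘBody-subst τ τ0 τk b
ΘBody-subst τ τ0 τk (t ∙f) rewrite τ0 = ΘReduct-subst τ τk t ∙f

ΘReduct-subst τ τk start        rewrite τk = start
ΘReduct-subst τ τk (unfolded b) rewrite τk =
  unfolded (ΘBody-subst (exts (exts τ)) ≡.refl ≡.refl b)
ΘReduct-subst τ τk (opened b) =
  opened (ΘBody-subst (exts τ) ≡.refl (cong (rename suc) τk) b)

ΘReduct-rename : ∀ {k k′ T} ρ → ρ k ≡ k′ → ΘReduct k T → ΘReduct k′ (rename ρ T)
ΘReduct-rename {T = T} ρ ρk t =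
  ≡.subst (ΘReduct _) (≡.sym (rename-is-subst ρ T)) (ΘReduct-subst (var ∘ ρ) (cong var ρk) t)

ΘBody-⟶β : ∀ {k B B′} → ΘBody k B → B ⟶β B′ → ΘBody k B′
ΘReduct-⟶β : ∀ {k T T′} → ΘReduct k T → T ⟶β T′ → ΘReduct k T′

ΘBody-⟶β (f∙ b)        (appL ())
ΘBody-⟶β (f∙ b)        (appR s) = f∙ ΘBody-⟶β b s
ΘBody-⟶β (t ∙f)        (appL s) = ΘReduct-⟶β t s ∙f
ΘBody-⟶β (t ∙f)        (appR ())
ΘBody-⟶β (opened b ∙f) β        = ΘBody-subst (sub0 (var 0)) ≡.refl ≡.refl b

ΘReduct-⟶β start            (appL β)         = unfolded (f∙ (start ∙f))
ΘReduct-⟶β start            (appL (appL s))  = ⊥-elim (W-normal s)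
ΘReduct-⟶β start            (appL (appR s))  = ⊥-elim (W-normal s)
ΘReduct-⟶β start            (appR ())
ΘReduct-⟶β {k} (unfolded b) β                =
  opened (ΘBody-subst (exts (sub0 (var k))) ≡.refl ≡.refl b)
ΘReduct-⟶β (unfolded b)     (appL (ξ (ξ s))) = unfolded (ΘBody-⟶β b s)
ΘReduct-⟶β (unfolded b)     (appR ())
ΘReduct-⟶β (opened b)       (ξ s)            = opened (ΘBody-⟶β b s)

module Marker (z : ℕ) where

  -- At binder depth d the marker z is the index d + z.
  data Guarded (d : ℕ) : Term → Set where
    var    : ∀ {i} → i ≢ d + z → Guarded d (var i)
    app    : ∀ {M N} → Guarded d M → Guarded d N → Guarded d (app M N)
    lam    : ∀ {M} → Guarded (suc d) M → Guarded d (lam M)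
    marked : ∀ {T N} → ΘReduct (d + z) T → Guarded d N → NoLocal d N → Guarded d (app T N)

  local-≢ : ∀ {i} d → i < d → i ≢ d + z
  local-≢ d i<d = <⇒≢ (<-≤-trans i<d (m≤m+n d z))

  shift-≢ : ∀ {d j} d′ → d + j ≢ d + z → d′ + j ≢ d′ + z
  shift-≢ {d} {j} d′ ne e = ne (cong (d +_) (+-cancelˡ-≡ d′ j z e))

  Guarded-rename : ∀ {d d′ M} ρ → (∀ i → i < d → ρ i < d′) → (∀ j → ρ (d + j) ≡ d′ + j) →
                   Guarded d M → Guarded d′ (rename ρ M)
  Guarded-rename {d} {d′} ρ local shift (var {i} i≢) with local-or-global d i
  ... | inj₁ i<d          = var (local-≢ d′ (local i i<d))
  ... | inj₂ (j , ≡.refl) = var (λ e → shift-≢ d′ i≢ (≡.trans (≡.sym (shift j)) e))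
  Guarded-rename ρ local shift (app g h) =
    app (Guarded-rename ρ local shift g) (Guarded-rename ρ local shift h)
  Guarded-rename {d} {d′} ρ local shift (lam g) =
    lam (Guarded-rename (ext ρ) local′ (cong suc ∘ shift) g)
    where
    local′ : ∀ i → i < suc d → ext ρ i < suc d′
    local′ zero    _         = s≤s z≤n
    local′ (suc i) (s≤s i<d) = s≤s (local i i<d)
  Guarded-rename ρ local shift (marked {N = N} t g noLocal) =
    marked (ΘReduct-rename ρ (shift z) t) (Guarded-rename ρ local shift g)
           (NoLocal-rename ρ shift N noLocal)

  Guarded-subst : ∀ {d d′ M} σ → (∀ i → i < d → Guarded d′ (σ i)) → (∀ j → σ (d + j) ≡ var (d′ + j)) →
                  Guarded d M → Guarded d′ (subst σ M)
  Guarded-subst {d} {d′} σ local shift (var {i} i≢) with local-or-global d i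
  ... | inj₁ i<d          = local i i<d
  ... | inj₂ (j , ≡.refl) = ≡.subst (Guarded d′) (≡.sym (shift j)) (var (shift-≢ d′ i≢))
  Guarded-subst σ local shift (app g h) =
    app (Guarded-subst σ local shift g) (Guarded-subst σ local shift h)
  Guarded-subst {d} {d′} σ local shift (lam g) =
    lam (Guarded-subst (exts σ) local′ (cong (rename suc) ∘ shift) g)
    where
    local′ : ∀ i → i < suc d → Guarded (suc d′) (exts σ i)
    local′ zero    _         = var (λ ())
    local′ (suc i) (s≤s i<d) = Guarded-rename suc (λ _ → s≤s) (λ _ → ≡.refl) (local i i<d)
  Guarded-subst σ local shift (marked {N = N} t g noLocal) =
    marked (ΘReduct-subst σ (shift z) t) (Guarded-subst σ local shift g)
           (NoLocal-subst σ shift N noLocal)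

  ΘBody-instantiate : ∀ {d B N} → Guarded d N → NoLocal d N →
                      ΘBody (suc (d + z)) B → Guarded d (B [ N ])
  ΘBody-instantiate g noLocal (f∙ b)          = app g (ΘBody-instantiate g noLocal b)
  ΘBody-instantiate {N = N} g noLocal (t ∙f) = marked (ΘReduct-subst (sub0 N) ≡.refl t) g noLocal

  Guarded-⟶β : ∀ {d M M′} → Guarded d M → M ⟶β M′ → Guarded d M′
  Guarded-⟶β (var _) ()
  Guarded-⟶β {d} (app (lam g) h) (β {N = N}) = Guarded-subst (sub0 N) local (λ _ → ≡.refl) g
    where
    local : ∀ i → i < suc d → Guarded d (sub0 N i)
    local zero    _         = h
    local (suc i) (s≤s i<d) = var (local-≢ d i<d)
  Guarded-⟶β (app g h) (appL s) = app (Guarded-⟶β g s) h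
  Guarded-⟶β (app g h) (appR s) = app g (Guarded-⟶β h s)
  Guarded-⟶β (lam g)   (ξ s)    = lam (Guarded-⟶β g s)
  Guarded-⟶β (marked (opened b) g noLocal) β        = ΘBody-instantiate g noLocal b
  Guarded-⟶β (marked t g noLocal)          (appL s) = marked (ΘReduct-⟶β t s) g noLocal
  Guarded-⟶β (marked t g noLocal)          (appR s) =
    marked t (Guarded-⟶β g s) (NoLocal-⟶β s noLocal)

  fresh⇒Guarded : ∀ {d} M → ¬ Free (d + z) M → Guarded d M
  fresh⇒Guarded (var i)   z∉M = var (z∉M ∘ ≡.sym)
  fresh⇒Guarded (app M N) z∉M =
    app (fresh⇒Guarded M (z∉M ∘ inj₁)) (fresh⇒Guarded N (z∉M ∘ inj₂))
  fresh⇒Guarded (lam M)   z∉M = lam (fresh⇒Guarded M z∉M)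

  Guarded-apps : ∀ {d M} Gs → Guarded d M → All (Guarded d) Gs → Guarded d (apps M Gs)
  Guarded-apps []       g []       = g
  Guarded-apps (G ∷ Gs) g (h ∷ hs) = Guarded-apps Gs (app g h) hs

  ΘBody-unguarded : ∀ d {B} → ΘBody (suc d + z) B → ¬ Guarded (suc d) B
  ΘReduct-unguarded : ∀ d {T} → ΘReduct (d + z) T → ¬ Guarded d T

  ΘBody-unguarded d (f∙ b) (app _ g)      = ΘBody-unguarded d b g
  ΘBody-unguarded d (f∙ b) (marked () _ _)
  ΘBody-unguarded d (t ∙f) (app g _)      = ΘReduct-unguarded (suc d) t g
  ΘBody-unguarded d (t ∙f) (marked _ _ noLocal) with noLocal {0} ≡.refl
  ... | ()

  ΘReduct-unguarded d start        (app _ (var ne))      = ne ≡.refl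
  ΘReduct-unguarded d start        (marked _ (var ne) _) = ne ≡.refl
  ΘReduct-unguarded d (unfolded _) (app _ (var ne))      = ne ≡.refl
  ΘReduct-unguarded d (unfolded _) (marked _ (var ne) _) = ne ≡.refl
  ΘReduct-unguarded d (opened b)   (lam g)               = ΘBody-unguarded d b g

  Θ-apps-≠β : ∀ G Gs → All (λ H → ¬ Free z H) (G ∷ Gs) → ¬ (apps (Θ z) (G ∷ Gs) =β Θ z)
  Θ-apps-≠β G Gs (z∉G ∷ z∉Gs) eq with church-rosser eq
  ... | R , lhs↠R , Θ↠R =
    ΘReduct-unguarded 0 (↠-preserves ΘReduct-⟶β start Θ↠R) (↠-preserves Guarded-⟶β lhs-guarded lhs↠R)
    where
    lhs-guarded : Guarded 0 (apps (Θ z) (G ∷ Gs))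
    lhs-guarded = Guarded-apps Gs (marked start (fresh⇒Guarded G z∉G) (λ _ → z≤n))
                                  (All.map (fresh⇒Guarded _) z∉Gs)

open Marker using (Θ-apps-≠β)

corollary3p6 : (Gs : List Term) → IsWFGV Gs →
    (∀ Y → IsFPC Y → apps Y Gs =β Y) → Gs ≡ []
corollary3p6 []       _ _     = ≡.refl
corollary3p6 (G ∷ Gs) _ fixes with fresh-for (G ∷ Gs)
... | z , z∉Gs = ⊥-elim (Θ-apps-≠β z G Gs z∉Gs (fixes (Θ z) (Θ-fpc z)))
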